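{- Let $V_T$ be a set of terminals, $V_N=\{0,1,\dots,n\}$ a finite set of nonterminals, $\Delta$ the set of PEG expressions over $V_T,V_N$, and $P_{exp}:V_N\to\Delta$. Then: (i) for all $P\in\mathbb{C}$ and $A\in\{0,\dots,n\}$, $P\le r_A^P$; (ii) for all $P,P'\in\mathbb{C}$ and $A\in\{0,\dots,n\}$, if $P\le P'$ then $r_A^P\le r_A^{P'}$; (iii) for all $P\in\mathbb{C}$ and $A\in\{0,\dots,n-1\}$, $r_{A+1}^P\le r_A^P$.
   Context: PEG expressions $\Delta$ are generated by: $\epsilon$, $[\cdot]$, $[a]$ ($a\in V_T$), $A$ ($A\in V_N$), $e_1;e_2$, $e_1/e_2$, $e*$, $!e$. A property map is $P:V_N\to\{\mathrm{true},\mathrm{false}\}^3$, $\mathbb{P}$ the set of all of them; $P\le P'$ iff for all $A$ and $i\in\{1,2,3\}$, $P(A)_i\Rightarrow P'(A)_i$. Define $g:\Delta\times\mathbb{P}\to\{\mathrm{true},\mathrm{false}\}^3$, $g(e,P)=(\bot(e),z(e),c(e))$, recursively: $g(\epsilon,P)=(\mathrm{false},\mathrm{true},\mathrm{false})$; $g([\cdot],P)=g([a],P)=(\mathrm{true},\mathrm{false},\mathrm{true})$; $g(A,P)=P(A)$; for $e_1;e_2$: $\bot=\bot(e_1)\vee((z(e_1)\vee c(e_1))\wedge\bot(e_2))$, $z=z(e_1)\wedge z(e_2)$, $c=(c(e_1)\wedge(z(e_2)\vee c(e_2)))\vee(z(e_1)\wedge c(e_2))$; for $e_1/e_2$: $\bot=\bot(e_1)\wedge\bot(e_2)$,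 $z=z(e_1)\vee(\bot(e_1)\wedge z(e_2))$, $c=c(e_1)\vee(\bot(e_1)\wedge c(e_2))$; for $e*$: $(\mathrm{false},\bot(e),c(e))$; for $!e$: $(z(e)\vee c(e),\bot(e),\mathrm{false})$. Define $\rho(A,P)\in\mathbb{P}$ by $\rho(A,P)(A)=g(P_{exp}(A),P)$ and $\rho(A,P)(B)=P(B)$ for $B\ne A$. Coherent maps: $\mathbb{C}=\{P\in\mathbb{P}:\forall A\in V_N,\ P\le\rho(A,P)\}$. For $P\in\mathbb{P}$ and $A\in\{0,\dots,n\}$ define $r_n^P=\rho(n,P)$ and, for $A<n$, $r_A^P=r_{A+1}^{\rho(A,P)}$. -}

module Defs where

open import Data.Nat using (ℕ; zero; suc; _∸_; _<?_)
open import Data.Fin using (Fin; zero; suc; fromℕ; fromℕ<; toℕ; _≟_)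
open import Data.Bool using (Bool; true; false; _∧_; _∨_; T)
open import Data.Product using (_×_; _,_; proj₁; proj₂)
open import Relation.Nullary using (yes; no)

data Δ (VT : Set) (n : ℕ) : Set where
  ε    : Δ VT n
  any  : Δ VT n
  term : VT → Δ VT n
  nt   : Fin (suc n) → Δ VT n
  _⨾_  : Δ VT n → Δ VT n → Δ VT n
  _⊘_  : Δ VT n → Δ VT n → Δ VT n
  star : Δ VT n → Δ VT n
  not  : Δ VT n → Δ VT n

Triple : Set
Triple = Bool × Bool × Bool

PMap : ℕ → Set
PMap n = Fin (suc n) → Triple

⊥ᵗ zᵗ cᵗ : Triple → Bool
⊥ᵗ t = proj₁ t
zᵗ t = proj₁ (proj₂ t)
cᵗ t = proj₂ (proj₂ t)

_≤ᵗ_ : Triple → Triple → Set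
t ≤ᵗ t' = (T (⊥ᵗ t) → T (⊥ᵗ t')) × (T (zᵗ t) → T (zᵗ t')) × (T (cᵗ t) → T (cᵗ t'))

_≤ᴾ_ : {n : ℕ} → PMap n → PMap n → Set
P ≤ᴾ P' = ∀ A → P A ≤ᵗ P' A

g : {VT : Set} {n : ℕ} → Δ VT n → PMap n → Triple
g ε P = (false , true , false)
g any P = (true , false , true)
g (term a) P = (true , false , true)
g (nt A) P = P A
g (e₁ ⨾ e₂) P =
  let t₁ = g e₁ P ; t₂ = g e₂ P in
  ( ⊥ᵗ t₁ ∨ ((zᵗ t₁ ∨ cᵗ t₁) ∧ ⊥ᵗ t₂)
  , zᵗ t₁ ∧ zᵗ t₂
  , (cᵗ t₁ ∧ (zᵗ t₂ ∨ cᵗ t₂)) ∨ (zᵗ t₁ ∧ cᵗ t₂) )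
g (e₁ ⊘ e₂) P =
  let t₁ = g e₁ P ; t₂ = g e₂ P in
  ( ⊥ᵗ t₁ ∧ ⊥ᵗ t₂
  , zᵗ t₁ ∨ (⊥ᵗ t₁ ∧ zᵗ t₂)
  , cᵗ t₁ ∨ (⊥ᵗ t₁ ∧ cᵗ t₂) )
g (star e) P = let t = g e P in (false , ⊥ᵗ t , cᵗ t)
g (not e) P = let t = g e P in (zᵗ t ∨ cᵗ t , ⊥ᵗ t , false)

ρ : {VT : Set} {n : ℕ} → (Fin (suc n) → Δ VT n) → Fin (suc n) → PMap n → PMap n
ρ Pexp A P B with B ≟ A
... | yes _ = g (Pexp A) P
... | no  _ = P B

Coherent : {VT : Set} {n : ℕ} → (Fin (suc n) → Δ VT n) → PMap n → Set
Coherent Pexp P = ∀ A → P ≤ᴾ ρ Pexp A P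

-- r_A^P : r_n^P = ρ(n,P); r_A^P = r_{A+1}^{ρ(A,P)} for A < n.
-- Auxiliary recursion on k = n - A (as a natural number):
--   r' k P = r_{n-k}^P, where n-k is the nonterminal opposite (fromℕ< …).
-- For k ≤ n, n ∸ k is a valid index; r' is only used with k = n - toℕ A.
finOf : {n : ℕ} → ℕ → Fin (suc n)
finOf {n} k with k <? suc n
... | yes k<n = fromℕ< k<n
... | no  _   = fromℕ n

r' : {VT : Set} {n : ℕ} → (Fin (suc n) → Δ VT n) → ℕ → PMap n → PMap n
r' {n = n} Pexp zero P = ρ Pexp (fromℕ n) P
r' {n = n} Pexp (suc k) P = r' Pexp k (ρ Pexp (finOf (n ∸ suc k)) P)

r : {VT : Set} {n : ℕ} → (Fin (suc n) → Δ VT n) → Fin (suc n) → PMap n → PMap n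
r {n = n} Pexp A P = r' Pexp (n ∸ toℕ A) P

-- Every Boolean connective in g is monotone for implication, so g e is monotone in P and
-- hence so is each update ρ A. A coherent P satisfies P ≤ ρ A P, and ρ A preserves
-- coherence; composing, r_A is monotone on all maps and inflationary on coherent ones,
-- and since r_A^P = r_{A+1}^{ρ(A,P)} ≥ r_{A+1}^P the sequence r_A^P decreases in A.
module Submission where

open import Defs
open import Data.Nat using (ℕ; suc; zero; _∸_)
open import Data.Fin using (Fin; zero; suc; inject₁; toℕ; _≟_)
open import Data.Product using (_×_; _,_)
open import Data.Bool using (_∧_; _∨_; T)
open import Data.Bool.Properties using (T-∧; T-∨)
open import Data.Sum using (inj₁; inj₂; [_,_]′)
open import Function using (_∘_; id)
open import Function.Bundles using (Equivalence)
open import Relation.Nullary using (yes; no; contradiction)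
open import Relation.Binary.PropositionalEquality using (_≡_; refl; subst)

open Equivalence using (to; from)

∧-mono : ∀ {a b c d} → (T a → T b) → (T c → T d) → T (a ∧ c) → T (b ∧ d)
∧-mono f h x = let (ta , tc) = to T-∧ x in from T-∧ (f ta , h tc)

∨-mono : ∀ {a b c d} → (T a → T b) → (T c → T d) → T (a ∨ c) → T (b ∨ d)
∨-mono f h = from T-∨ ∘ [ inj₁ ∘ f , inj₂ ∘ h ]′ ∘ to T-∨

≤ᵗ-refl : ∀ {t} → t ≤ᵗ t
≤ᵗ-refl = id , id , id

≤ᵗ-trans : ∀ {s t u} → s ≤ᵗ t → t ≤ᵗ u → s ≤ᵗ u
≤ᵗ-trans (b , z , c) (b' , z' , c') = b' ∘ b , z' ∘ z , c' ∘ c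

≤ᴾ-trans : ∀ {n} {P Q R : PMap n} → P ≤ᴾ Q → Q ≤ᴾ R → P ≤ᴾ R
≤ᴾ-trans p q A = ≤ᵗ-trans (p A) (q A)

g-mono : ∀ {VT n} (e : Δ VT n) {P P' : PMap n} → P ≤ᴾ P' → g e P ≤ᵗ g e P'
g-mono ε p = ≤ᵗ-refl
g-mono any p = ≤ᵗ-refl
g-mono (term a) p = ≤ᵗ-refl
g-mono (nt A) p = p A
g-mono (e₁ ⨾ e₂) p =
  let (b₁ , z₁ , c₁) = g-mono e₁ p ; (b₂ , z₂ , c₂) = g-mono e₂ p in
  ∨-mono b₁ (∧-mono (∨-mono z₁ c₁) b₂)
  , ∧-mono z₁ z₂
  , ∨-mono (∧-mono c₁ (∨-mono z₂ c₂)) (∧-mono z₁ c₂)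
g-mono (e₁ ⊘ e₂) p =
  let (b₁ , z₁ , c₁) = g-mono e₁ p ; (b₂ , z₂ , c₂) = g-mono e₂ p in
  ∧-mono b₁ b₂ , ∨-mono z₁ (∧-mono b₁ z₂) , ∨-mono c₁ (∧-mono b₁ c₂)
g-mono (star e) p = let (b , _ , c) = g-mono e p in id , b , c
g-mono (not e) p = let (b , z , c) = g-mono e p in ∨-mono z c , b , id

module _ {VT : Set} {n : ℕ} (Pexp : Fin (suc n) → Δ VT n) where

  ρ-mono : ∀ A {P P' : PMap n} → P ≤ᴾ P' → ρ Pexp A P ≤ᴾ ρ Pexp A P'
  ρ-mono A p B with B ≟ A
  ... | yes _ = g-mono (Pexp A) p
  ... | no _ = p B

  ρ-self : ∀ A P → ρ Pexp A P A ≡ g (Pexp A) P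
  ρ-self A P with A ≟ A
  ... | yes _ = refl
  ... | no A≢A = contradiction refl A≢A

  coherent⇒≤g : ∀ {P} → Coherent Pexp P → ∀ A → P A ≤ᵗ g (Pexp A) P
  coherent⇒≤g {P} coh A = subst (P A ≤ᵗ_) (ρ-self A P) (coh A A)

  ≤g⇒coherent : ∀ {P} → (∀ A → P A ≤ᵗ g (Pexp A) P) → Coherent Pexp P
  ≤g⇒coherent below A B with B ≟ A
  ... | yes refl = below B
  ... | no _ = ≤ᵗ-refl

  ρ-coherent : ∀ A {P} → Coherent Pexp P → Coherent Pexp (ρ Pexp A P)
  ρ-coherent A {P} coh = ≤g⇒coherent below
    where
    below : ∀ B → ρ Pexp A P B ≤ᵗ g (Pexp B) (ρ Pexp A P)
    below B with B ≟ A
    ... | yes refl = g-mono (Pexp B) (coh B)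
    ... | no _ = ≤ᵗ-trans (coherent⇒≤g coh B) (g-mono (Pexp B) (coh A))

  r'-mono : ∀ k {P P' : PMap n} → P ≤ᴾ P' → r' Pexp k P ≤ᴾ r' Pexp k P'
  r'-mono zero p = ρ-mono _ p
  r'-mono (suc k) p = r'-mono k (ρ-mono _ p)

  r'-inflationary : ∀ k {P} → Coherent Pexp P → P ≤ᴾ r' Pexp k P
  r'-inflationary zero coh = coh _
  r'-inflationary (suc k) coh = ≤ᴾ-trans (coh _) (r'-inflationary k (ρ-coherent _ coh))

  r'-≤-r'-suc : ∀ k {P} → Coherent Pexp P → r' Pexp k P ≤ᴾ r' Pexp (suc k) P
  r'-≤-r'-suc k coh = r'-mono k (coh _)

n∸inject₁[i]≡1+n∸suc[i] : ∀ {n} (i : Fin n) → n ∸ toℕ (inject₁ i) ≡ suc (n ∸ toℕ (suc i))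
n∸inject₁[i]≡1+n∸suc[i] {suc n} zero = refl
n∸inject₁[i]≡1+n∸suc[i] {suc n} (suc i) = n∸inject₁[i]≡1+n∸suc[i] i

lemma3p2 : {VT : Set} {n : ℕ} (Pexp : Fin (suc n) → Δ VT n) →
    ((P : PMap n) → Coherent Pexp P → (A : Fin (suc n)) → P ≤ᴾ r Pexp A P)
    × ((P P' : PMap n) → Coherent Pexp P → Coherent Pexp P' → (A : Fin (suc n)) →
        P ≤ᴾ P' → r Pexp A P ≤ᴾ r Pexp A P')
    × ((P : PMap n) → Coherent Pexp P → (A : Fin n) →
        r Pexp (suc A) P ≤ᴾ r Pexp (inject₁ A) P)
lemma3p2 {n = n} Pexp =
  (λ P coh A → r'-inflationary Pexp (n ∸ toℕ A) coh)
  , (λ P P' _ _ A P≤P' → r'-mono Pexp (n ∸ toℕ A) P≤P')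
  , decreasing
  where
  decreasing : (P : PMap n) → Coherent Pexp P → (A : Fin n) →
    r Pexp (suc A) P ≤ᴾ r Pexp (inject₁ A) P
  decreasing P coh A rewrite n∸inject₁[i]≡1+n∸suc[i] A =
    r'-≤-r'-suc Pexp (n ∸ toℕ (suc A)) coh
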